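{- Let $k\geq 1$ and $m\geq 2$ be integers, let $\mu$ be a partition of $k$, and fix a permutation $w_\mu\in\mathfrak{S}_k$ of cycle type $\mu$. Define the polynomial $$G_\mu(\mathbf{p},\mathbf{q})=G_\mu(p_1,\dots,p_m;q_1,\dots,q_m)=\sum_{\substack{(\alpha,\beta)\in\mathfrak{S}_k^{(m)}\times\mathfrak{S}_k^{(m)}\\ \alpha w_\mu=\beta}} \mathbf{p}^{\kappa(\alpha)}\mathbf{q}^{\kappa(\beta)},$$ where the sum is over all pairs of $m$-colored permutations with $\alpha w_\mu=\beta$ (notation in the context). Then for every $i$ with $1\leq i\leq m-1$, $$G_\mu(p_1,\dots,p_m;q_1,\dots,q_m)\big|_{q_{i+1}=q_i} = G_\mu(p_1,\dots,p_{i-1},p_i+p_{i+1},p_{i+2},\dots,p_m;\ q_1,\dots,q_{i-1},q_i,q_{i+2},\dots,q_m),$$ where the right-hand side is the polynomial $G_\mu$ defined in the same way with $m-1$ colors in place of $m$.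
   Context: $\mathfrak{S}_k$ is the symmetric group on $[k]=\{1,\dots,k\}$; permutations are multiplied from left to right, i.e. $uv$ means first apply $u$ and then $v$. For $u\in\mathfrak{S}_k$, $C(u)$ denotes the set of cycles of $u$ in its disjoint cycle decomposition (fixed points count as cycles of length 1). The set $\mathfrak{S}_k^{(m)}$ of $m$-colored permutations consists of pairs $(u,\varphi)$ with $u\in\mathfrak{S}_k$ and $\varphi:C(u)\to[m]$. For $\alpha=(u,\varphi)\in\mathfrak{S}_k^{(m)}$ and $v\in\mathfrak{S}_k$, the product $\alpha v=(w,\psi)\in\mathfrak{S}_k^{(m)}$ is defined by $w=uv$ and, for each cycle $\tau=(a_1,\dots,a_j)$ of $w$, $\psi(\tau)=\max\{\varphi(\rho_1),\dots,\varphi(\rho_j)\}$, where $\rho_r$ is the cycle of $u$ containing $a_r$. For $\alpha=(u,\varphi)\in\mathfrak{S}_k^{(m)}$, $\kappa_i(\alpha)$ is the number of cycles of $u$ colored $i$, and $\mathbf{p}^{\kappa(\alpha)}=\prod_{i=1}^m p_i^{\kappa_i(\alpha)}$, $\mathbf{q}^{\kappa(\beta)}=\prod_{i=1}^m q_i^{\kappa_i(\beta)}$, with $p_1,\dots,p_m,q_1,\dots,q_m$ indeterminates. -}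

module Defs where

open import Level using (Level)
open import Data.Nat as ℕ using (ℕ; zero; suc; _≤_)
open import Data.Fin as F using (Fin; toℕ; inject₁; punchIn)
open import Data.Fin.Properties using (all?; any?)
open import Data.Vec as V using (Vec; lookup; tabulate)
open import Data.Vec.Properties using (≡-dec)
open import Data.List as L using (List; []; _∷_; filter; allFin; concatMap)
open import Data.Nat.ListAction using (sum)
open import Data.List.Relation.Unary.All using (All)
open import Data.List.Relation.Unary.Linked using (Linked)
open import Data.List.Relation.Binary.Permutation.Propositional using (_↭_)
open import Data.Product using (_×_; _,_; proj₁; proj₂; ∃)
open import Data.Product.Properties using () renaming (≡-dec to ×-≡-dec)
open import Relation.Nullary using (Dec; yes; no; does)
open import Relation.Nullary.Decidable using (_×-dec_; ¬?)
open import Relation.Binary.PropositionalEquality using (_≡_)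
open import Algebra.Bundles using (CommutativeSemiring)

-- Permutations of [k] are encoded as vectors u : Vec (Fin k) k
-- (u maps x to lookup u x); [k] = {1..k} is Fin k = {0..k-1}.

IsPerm : ∀ {k} → Vec (Fin k) k → Set
IsPerm {k} u = ∀ (i j : Fin k) → lookup u i ≡ lookup u j → i ≡ j

isPerm? : ∀ {k} (u : Vec (Fin k) k) → Dec (IsPerm u)
isPerm? u = all? λ i → all? λ j → dec i j
  where
  dec : ∀ i j → Dec (lookup u i ≡ lookup u j → i ≡ j)
  dec i j with lookup u i F.≟ lookup u j | i F.≟ j
  ... | _     | yes e = yes λ _ → e
  ... | no ne | no _  = yes λ e → Data.Empty.⊥-elim (ne e)
    where import Data.Empty
  ... | yes e | no ne = no λ f → ne (f e)

iter : ∀ {k} → Vec (Fin k) k → ℕ → Fin k → Fin k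
iter u zero    x = x
iter u (suc j) x = iter u j (lookup u x)

-- product uv, multiplied left to right: first apply u, then v
_·_ : ∀ {k} → Vec (Fin k) k → Vec (Fin k) k → Vec (Fin k) k
u · v = tabulate λ x → lookup v (lookup u x)

InCycle : ∀ {k} → Vec (Fin k) k → Fin k → Fin k → Set
InCycle {k} u x y = ∃ λ (j : Fin k) → iter u (toℕ j) x ≡ y

inCycle? : ∀ {k} u (x y : Fin k) → Dec (InCycle u x y)
inCycle? u x y = any? λ j → iter u (toℕ j) x F.≟ y

IsCycleMin : ∀ {k} → Vec (Fin k) k → Fin k → Set
IsCycleMin {k} u x = ∀ (j : Fin k) → toℕ x ≤ toℕ (iter u (toℕ j) x)

isCycleMin? : ∀ {k} u (x : Fin k) → Dec (IsCycleMin u x)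
isCycleMin? u x = all? λ j → toℕ x ℕ.≤? toℕ (iter u (toℕ j) x)

cycleReps : ∀ {k} → Vec (Fin k) k → List (Fin k)
cycleReps u = filter (isCycleMin? u) (allFin _)

count : ∀ {a p} {A : Set a} {P : A → Set p} → (∀ x → Dec (P x)) → List A → ℕ
count P? xs = L.length (filter P? xs)

cycleLength : ∀ {k} → Vec (Fin k) k → Fin k → ℕ
cycleLength u x = count (inCycle? u x) (allFin _)

HasCycleType : ∀ {k} → Vec (Fin k) k → List ℕ → Set
HasCycleType u μ = L.map (cycleLength u) (cycleReps u) ↭ μ

IsPartition : ℕ → List ℕ → Set
IsPartition k μ = All (1 ≤_) μ × Linked (λ a b → b ≤ a) μ × sum μ ≡ k

-- m-colored permutations. A coloring φ : C(u) → [m] of the cycles of u is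
-- encoded as a map φ : [k] → [m] constant on the cycles of u.

ColorConst : ∀ {k m} → Vec (Fin k) k → Vec (Fin m) k → Set
ColorConst {k} u φ = ∀ (x : Fin k) → lookup φ (lookup u x) ≡ lookup φ x

colorConst? : ∀ {k m} u (φ : Vec (Fin m) k) → Dec (ColorConst u φ)
colorConst? u φ = all? λ x → lookup φ (lookup u x) F.≟ lookup φ x

CPerm : ℕ → ℕ → Set
CPerm k m = Vec (Fin k) k × Vec (Fin m) k

IsCPerm : ∀ {k m} → CPerm k m → Set
IsCPerm (u , φ) = IsPerm u × ColorConst u φ

isCPerm? : ∀ {k m} (α : CPerm k m) → Dec (IsCPerm α)
isCPerm? (u , φ) = isPerm? u ×-dec colorConst? u φ

allVecs : (k n : ℕ) → List (Vec (Fin n) k)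
allVecs zero    n = V.[] ∷ []
allVecs (suc k) n = concatMap (λ x → L.map (x V.∷_) (allVecs k n)) (allFin n)

allCPerms : (k m : ℕ) → List (CPerm k m)
allCPerms k m = filter isCPerm?
  (concatMap (λ u → L.map (u ,_) (allVecs k m)) (allVecs k k))

maxF : ∀ {m} → Fin m → Fin m → Fin m
maxF a b with toℕ a ℕ.≤? toℕ b
... | yes _ = b
... | no  _ = a

maxAlong : ∀ {k m} → Vec (Fin k) k → Vec (Fin m) k → ℕ → Fin k → Fin m
maxAlong w φ zero    x = lookup φ x
maxAlong w φ (suc j) x = maxF (lookup φ x) (maxAlong w φ j (lookup w x))

-- α v = (uv, ψ), ψ(cycle τ of uv) = max of φ over the cycles of u meeting τ.
-- Since the cycle of uv through a is {(uv)^j a : j < k}, ψ(a) = max_{j<k} φ((uv)^j a).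
_⋆_ : ∀ {k m} → CPerm k m → Vec (Fin k) k → CPerm k m
_⋆_ {zero}  (u , φ) v = (u · v , φ)
_⋆_ {suc k} (u , φ) v = (w , tabulate (maxAlong w φ k))
  where w = u · v

κ : ∀ {k m} → CPerm k m → Fin m → ℕ
κ (u , φ) i = count (λ x → lookup φ x F.≟ i) (cycleReps u)

-- Evaluation of G_μ in an arbitrary commutative semiring (a polynomial
-- identity with ℕ coefficients holds iff it holds for all evaluations in
-- all commutative semirings, e.g. in the polynomial semiring itself).

module _ {c ℓ : Level} (R : CommutativeSemiring c ℓ) where
  open CommutativeSemiring R

  pow : Carrier → ℕ → Carrier
  pow x zero    = 1#
  pow x (suc n) = x * pow x n

  prodFin : ∀ {m} → (Fin m → Carrier) → Carrier
  prodFin {zero}  f = 1#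
  prodFin {suc m} f = f F.zero * prodFin (λ i → f (F.suc i))

  sumList : ∀ {a} {A : Set a} → (A → Carrier) → List A → Carrier
  sumList f []       = 0#
  sumList f (x ∷ xs) = f x + sumList f xs

  mono : ∀ {k m} → (Fin m → Carrier) → CPerm k m → Carrier
  mono p α = prodFin λ i → pow (p i) (κ α i)

  G : ∀ {k} (m : ℕ) → Vec (Fin k) k → (Fin m → Carrier) → (Fin m → Carrier) → Carrier
  G {k} m w p q =
    sumList (λ αβ → mono p (proj₁ αβ) * mono q (proj₂ αβ))
      (filter (λ αβ → ×-≡-dec (≡-dec F._≟_) (≡-dec F._≟_) (proj₁ αβ ⋆ w) (proj₂ αβ))
        (concatMap (λ α → L.map (α ,_) (allCPerms k m)) (allCPerms k m)))

  -- q with q_{i+1} replaced by q_i (colors 0-based: i ↦ inject₁ i, i+1 ↦ suc i)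
  qIdentify : ∀ {n} → Fin (suc n) → (Fin (suc (suc n)) → Carrier) → Fin (suc (suc n)) → Carrier
  qIdentify i q j with j F.≟ F.suc i
  ... | yes _ = q (inject₁ i)
  ... | no  _ = q j

  -- (p_1,…,p_{i-1}, p_i + p_{i+1}, p_{i+2},…,p_m)
  pMerge : ∀ {n} → Fin (suc n) → (Fin (suc (suc n)) → Carrier) → Fin (suc n) → Carrier
  pMerge i p j with j F.≟ i
  ... | yes _ = p (inject₁ i) + p (F.suc i)
  ... | no  _ = p (punchIn (F.suc i) j)

  -- (q_1,…,q_i, q_{i+2},…,q_m)
  qDrop : ∀ {n} → Fin (suc n) → (Fin (suc (suc n)) → Carrier) → Fin (suc n) → Carrier
  qDrop i q j = q (punchIn (F.suc i) j)

-- Only β = α w contributes to G, so G is a sum over colored permutations α = (u , φ) of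
-- p^κ(α) q^κ(α w).  After identifying q_{i+1} with q_i, the q-factor only depends on the
-- coloring pinch i ∘ φ in which the colors i and i+1 are merged, since taking maxima of
-- colors commutes with the monotone map pinch i.  Grouping the colorings φ of u by
-- φ′ = pinch i ∘ φ, the fibre over φ′ consists of the independent choices of i or i+1
-- for each cycle colored i by φ′, and summing p over these choices turns each factor
-- p_i into p_i + p_{i+1}.

module Submission where

open import Defs
open import Level using (_⊔_)
open import Function using (_∘_; id)
open import Data.Empty using (⊥-elim)
open import Data.Nat as ℕ using (ℕ; zero; suc; _≤_)
import Data.Nat.Properties as ℕ
open import Data.Nat.DivMod using (_%_; _/_; m≡m%n+[m/n]*n; m%n<n)
open import Data.Fin as F using (Fin; toℕ; pinch; punchIn; inject₁)
import Data.Fin.Properties as F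
open import Data.Vec as V using (Vec; lookup; tabulate)
import Data.Vec.Properties as V
open import Data.List as L using (List; []; _∷_; filter; allFin; concatMap; _++_)
import Data.List.Properties as L
open import Data.Product using (_×_; _,_; proj₁; proj₂; ∃; ∃₂; Σ)
open import Data.Product.Properties using () renaming (≡-dec to ×-≡-dec)
open import Relation.Nullary using (Dec; yes; no; does; ¬_)
open import Data.Bool using (if_then_else_)
open import Relation.Nullary.Decidable using (_×-dec_; _→-dec_; ¬?)
open import Relation.Unary using (Decidable)
open import Relation.Binary using (DecidableEquality)
open import Relation.Binary.PropositionalEquality as P using (_≡_; _≢_; cong)
open import Algebra.Bundles using (CommutativeSemiring)

module Combinatorics where
  open import Data.Nat using (_+_; _*_; z≤n; s≤s)
  open P using (refl; sym; trans; cong₂; subst)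
  open P.≡-Reasoning

  ≡-by-lookup : ∀ {a} {A : Set a} {n} {xs ys : Vec A n} → (∀ x → lookup xs x ≡ lookup ys x) → xs ≡ ys
  ≡-by-lookup {xs = xs} {ys} eq =
    trans (sym (V.tabulate∘lookup xs)) (trans (V.tabulate-cong eq) (V.tabulate∘lookup ys))

  iter-+ : ∀ {K} (v : Vec (Fin K) K) m n x → iter v (m + n) x ≡ iter v n (iter v m x)
  iter-+ v zero    n x = refl
  iter-+ v (suc m) n x = iter-+ v m n (lookup v x)

  iter-injective : ∀ {K} {v : Vec (Fin K) K} → IsPerm v → ∀ j {x y} → iter v j x ≡ iter v j y → x ≡ y
  iter-injective v-perm zero    e = e
  iter-injective v-perm (suc j) e = v-perm _ _ (iter-injective v-perm j e)

  iter-*-period : ∀ {K} (v : Vec (Fin K) K) d x → iter v d x ≡ x → ∀ q → iter v (q * d) x ≡ x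
  iter-*-period v d x e zero    = refl
  iter-*-period v d x e (suc q) =
    trans (iter-+ v d (q * d) x) (trans (cong (iter v (q * d)) e) (iter-*-period v d x e q))

  least-witness : ∀ {n p} {Q : Fin n → Set p} → Decidable Q → ∀ {y} → Q y →
          Σ (Fin n) λ x → Q x × (∀ z → Q z → toℕ x ≤ toℕ z)
  least-witness {suc n} Q? {y} qy with Q? F.zero
  ... | yes q0 = F.zero , q0 , λ _ _ → z≤n
  least-witness {suc n} Q? {F.zero}  qy | no ¬q0 = ⊥-elim (¬q0 qy)
  least-witness {suc n} {Q = Q} Q? {F.suc y} qy | no ¬q0 with least-witness (Q? ∘ F.suc) qy
  ... | x , qx , x-min = F.suc x , qx , suc-min
    where
    suc-min : ∀ z → Q z → suc (toℕ x) ≤ toℕ z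
    suc-min F.zero    qz = ⊥-elim (¬q0 qz)
    suc-min (F.suc z) qz = s≤s (x-min z qz)

  colorConst-iter : ∀ {K m} (u : Vec (Fin K) K) (φ : Vec (Fin m) K) → ColorConst u φ →
                    ∀ j x → lookup φ (iter u j x) ≡ lookup φ x
  colorConst-iter u φ φ-const zero    x = refl
  colorConst-iter u φ φ-const (suc j) x = trans (colorConst-iter u φ φ-const j _) (φ-const x)

  colorConst-inCycle : ∀ {K m} (u : Vec (Fin K) K) (φ : Vec (Fin m) K) → ColorConst u φ →
                       ∀ {x y} → InCycle u x y → lookup φ y ≡ lookup φ x
  colorConst-inCycle u φ φ-const (j , refl) = colorConst-iter u φ φ-const (toℕ j) _

  module Cycles {K} (v : Vec (Fin K) K) (v-perm : IsPerm v) where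

    period : ∀ x → ∃ λ d → suc d ≤ K × iter v (suc d) x ≡ x
    period x with F.pigeonhole (ℕ.n<1+n K) (λ (a : Fin (suc K)) → iter v (toℕ a) x)
    ... | a , b , a<b , e with ℕ.m≤n⇒∃[o]m+o≡n a<b
    ... | d , a+1+d≡b = d , 1+d≤K , iter-injective v-perm (toℕ a) same
      where
      b≡a+1+d : toℕ b ≡ toℕ a + suc d
      b≡a+1+d = sym (trans (ℕ.+-suc (toℕ a) d) a+1+d≡b)
      1+d≤K : suc d ≤ K
      1+d≤K = ℕ.≤-trans (ℕ.m≤n+m (suc d) (toℕ a))
                (subst (_≤ K) b≡a+1+d (ℕ.≤-pred (F.toℕ<n b)))
      same : iter v (toℕ a) (iter v (suc d) x) ≡ iter v (toℕ a) x
      same = trans (sym (iter-+ v (suc d) (toℕ a) x))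
               (trans (cong (λ t → iter v t x) (trans (ℕ.+-comm (suc d) (toℕ a)) (sym b≡a+1+d))) (sym e))

    -- reduce the exponent modulo the period
    inCycle-iter : ∀ x n → InCycle v x (iter v n x)
    inCycle-iter x n with period x
    ... | d , 1+d≤K , e = F.fromℕ< r<K , trans (cong (λ t → iter v t x) (F.toℕ-fromℕ< r<K)) reduced
      where
      r<K : n % suc d ℕ.< K
      r<K = ℕ.≤-trans (m%n<n n (suc d)) 1+d≤K
      reduced : iter v (n % suc d) x ≡ iter v n x
      reduced = begin
        iter v (n % suc d) x
          ≡⟨ cong (iter v (n % suc d)) (sym (iter-*-period v (suc d) x e (n / suc d))) ⟩
        iter v (n % suc d) (iter v (n / suc d * suc d) x)
          ≡⟨ sym (iter-+ v (n / suc d * suc d) (n % suc d) x) ⟩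
        iter v (n / suc d * suc d + n % suc d) x
          ≡⟨ cong (λ t → iter v t x) (trans (ℕ.+-comm _ (n % suc d)) (sym (m≡m%n+[m/n]*n n (suc d)))) ⟩
        iter v n x ∎

    inCycle-refl : ∀ x → InCycle v x x
    inCycle-refl x = inCycle-iter x 0

    inCycle-trans : ∀ {x y z} → InCycle v x y → InCycle v y z → InCycle v x z
    inCycle-trans {x} (a , refl) (b , refl) with inCycle-iter x (toℕ a + toℕ b)
    ... | j , e = j , trans e (iter-+ v (toℕ a) (toℕ b) x)

    inCycle-lookup⁻ : ∀ {x y} → InCycle v (lookup v x) y → InCycle v x y
    inCycle-lookup⁻ {x} (j , refl) = inCycle-iter x (suc (toℕ j))

    inCycle-lookup⁺ : ∀ {x y} → InCycle v x y → InCycle v (lookup v x) y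
    inCycle-lookup⁺ {x} (j , refl) with period x
    ... | d , _ , e with inCycle-iter (lookup v x) (d + toℕ j)
    ... | l , e′ = l , trans e′ (trans (iter-+ v (suc d) (toℕ j) x) (cong (iter v (toℕ j)) e))

    cycleMin : Fin K → Fin K
    cycleMin x = proj₁ (least-witness (inCycle? v x) (inCycle-refl x))

    inCycle-cycleMin : ∀ x → InCycle v x (cycleMin x)
    inCycle-cycleMin x = proj₁ (proj₂ (least-witness (inCycle? v x) (inCycle-refl x)))

    cycleMin-≤ : ∀ x {z} → InCycle v x z → toℕ (cycleMin x) ≤ toℕ z
    cycleMin-≤ x = proj₂ (proj₂ (least-witness (inCycle? v x) (inCycle-refl x))) _

    isCycleMin-cycleMin : ∀ x → IsCycleMin v (cycleMin x)
    isCycleMin-cycleMin x j = cycleMin-≤ x (inCycle-trans (inCycle-cycleMin x) (inCycle-iter (cycleMin x) (toℕ j)))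

    cycleMin-lookup : ∀ x → cycleMin (lookup v x) ≡ cycleMin x
    cycleMin-lookup x = F.toℕ-injective (ℕ.≤-antisym
      (cycleMin-≤ (lookup v x) (inCycle-lookup⁺ (inCycle-cycleMin x)))
      (cycleMin-≤ x (inCycle-lookup⁻ (inCycle-cycleMin (lookup v x)))))

    cycleMin-fixed : ∀ {x} → IsCycleMin v x → cycleMin x ≡ x
    cycleMin-fixed {x} x-min with inCycle-cycleMin x
    ... | j , e = F.toℕ-injective (ℕ.≤-antisym (cycleMin-≤ x (inCycle-refl x)) (subst (λ z → toℕ x ≤ toℕ z) e (x-min j)))

    colorConst-map-onMins : ∀ {m m′} (f : Fin m → Fin m′) {φ′ φ} → ColorConst v φ′ → ColorConst v φ →
      (∀ x → IsCycleMin v x → lookup φ′ x ≡ f (lookup φ x)) → φ′ ≡ V.map f φ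
    colorConst-map-onMins f {φ′} {φ} φ′-const φ-const agree-on-mins = ≡-by-lookup λ x → begin
      lookup φ′ x                   ≡⟨ sym (colorConst-inCycle v φ′ φ′-const (inCycle-cycleMin x)) ⟩
      lookup φ′ (cycleMin x)        ≡⟨ agree-on-mins (cycleMin x) (isCycleMin-cycleMin x) ⟩
      f (lookup φ (cycleMin x))     ≡⟨ cong f (colorConst-inCycle v φ φ-const (inCycle-cycleMin x)) ⟩
      f (lookup φ x)                ≡⟨ sym (V.lookup-map x f φ) ⟩
      lookup (V.map f φ) x          ∎

    ZeroOffMins : ∀ {m} → Vec (Fin (suc m)) K → Set
    ZeroOffMins t = ∀ x → ¬ IsCycleMin v x → lookup t x ≡ F.zero

    zeroOffMins? : ∀ {m} → Decidable (ZeroOffMins {m})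
    zeroOffMins? t = F.all? (λ x → ¬? (isCycleMin? v x) →-dec (lookup t x F.≟ F.zero))

    restrictToMins : ∀ {m} → Vec (Fin (suc m)) K → Vec (Fin (suc m)) K
    restrictToMins φ = tabulate (λ x → if does (isCycleMin? v x) then lookup φ x else F.zero)

    spread : ∀ {m} → Vec (Fin m) K → Vec (Fin m) K
    spread t = tabulate (λ x → lookup t (cycleMin x))

    lookup-spread-min : ∀ {m} (t : Vec (Fin m) K) {x} → IsCycleMin v x → lookup (spread t) x ≡ lookup t x
    lookup-spread-min t {x} x-min = trans (V.lookup∘tabulate _ x) (cong (lookup t) (cycleMin-fixed x-min))

    zeroOffMins-restrictToMins : ∀ {m} (φ : Vec (Fin (suc m)) K) → ZeroOffMins (restrictToMins φ)
    zeroOffMins-restrictToMins φ x ¬min = trans (V.lookup∘tabulate _ x) (dropped (isCycleMin? v x))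
      where
      dropped : (min? : Dec (IsCycleMin v x)) → (if does min? then lookup φ x else F.zero) ≡ F.zero
      dropped (yes min) = ⊥-elim (¬min min)
      dropped (no _)    = refl

    spread-restrictToMins : ∀ {m} (φ : Vec (Fin (suc m)) K) → ColorConst v φ → spread (restrictToMins φ) ≡ φ
    spread-restrictToMins φ φ-const = ≡-by-lookup λ x →
      trans (V.lookup∘tabulate _ x) (trans (V.lookup∘tabulate _ (cycleMin x)) (kept x (isCycleMin? v (cycleMin x))))
      where
      kept : ∀ x (min? : Dec (IsCycleMin v (cycleMin x))) → (if does min? then lookup φ (cycleMin x) else F.zero) ≡ lookup φ x
      kept x (yes _)    = colorConst-inCycle v φ φ-const (inCycle-cycleMin x)
      kept x (no ¬min)  = ⊥-elim (¬min (isCycleMin-cycleMin x))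

    colorConst-spread : ∀ {m} (t : Vec (Fin m) K) → ColorConst v (spread t)
    colorConst-spread t x = trans (V.lookup∘tabulate _ (lookup v x))
      (trans (cong (lookup t) (cycleMin-lookup x)) (sym (V.lookup∘tabulate _ x)))

    restrictToMins-spread : ∀ {m} (t : Vec (Fin (suc m)) K) → ZeroOffMins t → restrictToMins (spread t) ≡ t
    restrictToMins-spread t zero-off = ≡-by-lookup λ x → trans (V.lookup∘tabulate _ x) (kept x (isCycleMin? v x))
      where
      kept : ∀ x (min? : Dec (IsCycleMin v x)) → (if does min? then lookup (spread t) x else F.zero) ≡ lookup t x
      kept x (yes min)  = lookup-spread-min t min
      kept x (no ¬min)  = sym (zero-off x ¬min)

  ·-isPerm : ∀ {K} (u v : Vec (Fin K) K) → IsPerm u → IsPerm v → IsPerm (u · v)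
  ·-isPerm u v u-perm v-perm i j e =
    u-perm i j (v-perm _ _ (trans (sym (V.lookup∘tabulate _ i)) (trans e (V.lookup∘tabulate _ j))))

  maxF-≥ˡ : ∀ {m} (a b : Fin m) → toℕ a ≤ toℕ (maxF a b)
  maxF-≥ˡ a b with toℕ a ℕ.≤? toℕ b
  ... | yes a≤b = a≤b
  ... | no  _   = ℕ.≤-refl

  maxF-≥ʳ : ∀ {m} (a b : Fin m) → toℕ b ≤ toℕ (maxF a b)
  maxF-≥ʳ a b with toℕ a ℕ.≤? toℕ b
  ... | yes _   = ℕ.≤-refl
  ... | no  a≰b = ℕ.<⇒≤ (ℕ.≰⇒> a≰b)

  maxF-lub : ∀ {m} (a b : Fin m) {c} → toℕ a ≤ c → toℕ b ≤ c → toℕ (maxF a b) ≤ c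
  maxF-lub a b a≤c b≤c with toℕ a ℕ.≤? toℕ b
  ... | yes _ = b≤c
  ... | no  _ = a≤c

  maxAlong-≥ : ∀ {K m} (w : Vec (Fin K) K) (φ : Vec (Fin m) K) n j x → j ≤ n →
               toℕ (lookup φ (iter w j x)) ≤ toℕ (maxAlong w φ n x)
  maxAlong-≥ w φ zero    zero    x _         = ℕ.≤-refl
  maxAlong-≥ w φ (suc n) zero    x _         = maxF-≥ˡ (lookup φ x) _
  maxAlong-≥ w φ (suc n) (suc j) x (s≤s j≤n) =
    ℕ.≤-trans (maxAlong-≥ w φ n j (lookup w x) j≤n) (maxF-≥ʳ (lookup φ x) _)

  maxAlong-lub : ∀ {K m} (w : Vec (Fin K) K) (φ : Vec (Fin m) K) n x {c} →
                 (∀ j → j ≤ n → toℕ (lookup φ (iter w j x)) ≤ c) → toℕ (maxAlong w φ n x) ≤ c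
  maxAlong-lub w φ zero    x bound = bound 0 z≤n
  maxAlong-lub w φ (suc n) x bound =
    maxF-lub (lookup φ x) _ (bound 0 z≤n) (maxAlong-lub w φ n (lookup w x) (λ j j≤n → bound (suc j) (s≤s j≤n)))

  module _ {k m} (w : Vec (Fin (suc k)) (suc k)) (w-perm : IsPerm w) (φ : Vec (Fin m) (suc k)) where
    open Cycles w w-perm

    maxAlong-≥-inCycle : ∀ x {y} → InCycle w x y → toℕ (lookup φ y) ≤ toℕ (maxAlong w φ k x)
    maxAlong-≥-inCycle x (j , refl) = maxAlong-≥ w φ k (toℕ j) x (ℕ.≤-pred (F.toℕ<n j))

    maxAlong-lookup : ∀ x → maxAlong w φ k (lookup w x) ≡ maxAlong w φ k x
    maxAlong-lookup x = F.toℕ-injective (ℕ.≤-antisym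
      (maxAlong-lub w φ k (lookup w x) (λ j _ → maxAlong-≥-inCycle x (inCycle-lookup⁻ (inCycle-iter (lookup w x) j))))
      (maxAlong-lub w φ k x (λ j _ → maxAlong-≥-inCycle (lookup w x) (inCycle-lookup⁺ (inCycle-iter x j)))))

  ⋆-isCPerm : ∀ {k m} {α : CPerm (suc k) m} {w : Vec (Fin (suc k)) (suc k)} →
              IsCPerm α → IsPerm w → IsCPerm (α ⋆ w)
  ⋆-isCPerm {k} {α = u , φ} {w} (u-perm , _) w-perm = uw-perm , ψ-const
    where
    uw-perm : IsPerm (u · w)
    uw-perm = ·-isPerm u w u-perm w-perm
    ψ-const : ColorConst (u · w) (tabulate (maxAlong (u · w) φ k))
    ψ-const x = trans (V.lookup∘tabulate (maxAlong (u · w) φ k) (lookup (u · w) x))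
                  (trans (maxAlong-lookup (u · w) uw-perm φ x) (sym (V.lookup∘tabulate (maxAlong (u · w) φ k) x)))

  pinch-maxF : ∀ {n} (i : Fin n) (a b : Fin (suc n)) → pinch i (maxF a b) ≡ maxF (pinch i a) (pinch i b)
  pinch-maxF i a b with toℕ a ℕ.≤? toℕ b | toℕ (pinch i a) ℕ.≤? toℕ (pinch i b)
  ... | yes _   | yes _    = refl
  ... | yes a≤b | no  a′≰b′ = ⊥-elim (a′≰b′ (F.pinch-mono-≤ i a≤b))
  ... | no  a≰b | yes a′≤b′ = F.toℕ-injective (ℕ.≤-antisym a′≤b′ (F.pinch-mono-≤ i (ℕ.<⇒≤ (ℕ.≰⇒> a≰b))))
  ... | no  _   | no  _    = refl

  maxAlong-pinch : ∀ {K n} (i : Fin n) (w : Vec (Fin K) K) (φ : Vec (Fin (suc n)) K) j x →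
                   maxAlong w (V.map (pinch i) φ) j x ≡ pinch i (maxAlong w φ j x)
  maxAlong-pinch i w φ zero    x = V.lookup-map x (pinch i) φ
  maxAlong-pinch i w φ (suc j) x =
    trans (cong₂ maxF (V.lookup-map x (pinch i) φ) (maxAlong-pinch i w φ j (lookup w x)))
          (sym (pinch-maxF i (lookup φ x) _))

  pinch-suc : ∀ {n} (i : Fin n) → pinch i (F.suc i) ≡ i
  pinch-suc {suc n} F.zero    = refl
  pinch-suc {suc n} (F.suc i) = cong F.suc (pinch-suc i)

  punchIn-suc-self : ∀ {n} (i : Fin n) → punchIn (F.suc i) i ≡ inject₁ i
  punchIn-suc-self F.zero    = refl
  punchIn-suc-self (F.suc i) = cong F.suc (punchIn-suc-self i)

  pinch-punchIn : ∀ {n} (i c : Fin n) → pinch i (punchIn (F.suc i) c) ≡ c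
  pinch-punchIn {suc n} i         F.zero    = refl
  pinch-punchIn {suc n} F.zero    (F.suc c) = refl
  pinch-punchIn {suc n} (F.suc i) (F.suc c) = cong F.suc (pinch-punchIn i c)

  punchIn-pinch : ∀ {n} (i : Fin n) {c : Fin (suc n)} → c ≢ F.suc i → punchIn (F.suc i) (pinch i c) ≡ c
  punchIn-pinch {suc n} i         {F.zero}            _   = refl
  punchIn-pinch {suc n} F.zero    {F.suc F.zero}      c≢1 = ⊥-elim (c≢1 refl)
  punchIn-pinch {suc n} F.zero    {F.suc (F.suc c)}   _   = refl
  punchIn-pinch {suc n} (F.suc i) {F.suc c}           c≢i = cong F.suc (punchIn-pinch i (c≢i ∘ cong F.suc))

  inject₁≢suc : ∀ {n} (i : Fin n) → inject₁ i ≢ F.suc i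
  inject₁≢suc i e = F.punchInᵢ≢i (F.suc i) i (trans (punchIn-suc-self i) e)

open Combinatorics

pairs : ∀ {a b} {A : Set a} {B : Set b} → List A → List B → List (A × B)
pairs xs ys = concatMap (λ x → L.map (x ,_) ys) xs

module Sums {c ℓ} (R : CommutativeSemiring c ℓ) where
  open CommutativeSemiring R renaming (refl to ≈-refl)
  open import Relation.Binary.Reasoning.Setoid setoid
  open import Algebra.Properties.CommutativeSemigroup *-commutativeSemigroup using () renaming (interchange to *-interchange)

  ∑-syntax : ∀ {a} {A : Set a} → List A → (A → Carrier) → Carrier
  ∑-syntax xs f = sumList R f xs
  syntax ∑-syntax xs (λ x → e) = ∑[ x ∈ xs ] e

  prodList : ∀ {a} {A : Set a} → (A → Carrier) → List A → Carrier
  prodList f []       = 1#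
  prodList f (x ∷ xs) = f x * prodList f xs

  ∏-syntax : ∀ {a} {A : Set a} → List A → (A → Carrier) → Carrier
  ∏-syntax xs f = prodList f xs
  syntax ∏-syntax xs (λ x → e) = ∏[ x ∈ xs ] e

  ⟦_⟧ : ∀ {p} {P : Set p} → Dec P → Carrier
  ⟦ yes _ ⟧ = 1#
  ⟦ no  _ ⟧ = 0#

  _^⟦_⟧ : ∀ {p} {P : Set p} → Carrier → Dec P → Carrier
  a ^⟦ yes _ ⟧ = a
  a ^⟦ no  _ ⟧ = 1#

  ≈-reflexive : ∀ {x y} → x ≡ y → x ≈ y
  ≈-reflexive P.refl = ≈-refl

  ⟦⟧-cong : ∀ {p q} {P : Set p} {Q : Set q} → (P → Q) → (Q → P) → (a : Dec P) (b : Dec Q) → ⟦ a ⟧ ≈ ⟦ b ⟧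
  ⟦⟧-cong P⇒Q Q⇒P (yes _)  (yes _)  = ≈-refl
  ⟦⟧-cong P⇒Q Q⇒P (yes p)  (no ¬q)  = ⊥-elim (¬q (P⇒Q p))
  ⟦⟧-cong P⇒Q Q⇒P (no ¬p)  (yes q)  = ⊥-elim (¬p (Q⇒P q))
  ⟦⟧-cong P⇒Q Q⇒P (no _)   (no _)   = ≈-refl

  ⟦⟧-× : ∀ {p q} {P : Set p} {Q : Set q} (a : Dec P) (b : Dec Q) → ⟦ a ×-dec b ⟧ ≈ ⟦ a ⟧ * ⟦ b ⟧
  ⟦⟧-× (yes _) (yes _) = sym (*-identityˡ _)
  ⟦⟧-× (yes _) (no _)  = sym (*-identityˡ _)
  ⟦⟧-× (no _)  _       = sym (zeroˡ _)

  ⟦⟧≈1 : ∀ {p} {P : Set p} (a : Dec P) → P → ⟦ a ⟧ ≈ 1#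
  ⟦⟧≈1 (yes _) _  = ≈-refl
  ⟦⟧≈1 (no ¬p) p  = ⊥-elim (¬p p)

  ⟦⟧≈0 : ∀ {p} {P : Set p} (a : Dec P) → ¬ P → ⟦ a ⟧ ≈ 0#
  ⟦⟧≈0 (yes p) ¬p = ⊥-elim (¬p p)
  ⟦⟧≈0 (no _)  _  = ≈-refl

  ⟦⟧*-congˡ : ∀ {p} {P : Set p} (a : Dec P) {x y} → (P → x ≈ y) → ⟦ a ⟧ * x ≈ ⟦ a ⟧ * y
  ⟦⟧*-congˡ (yes p) x≈y = *-congˡ (x≈y p)
  ⟦⟧*-congˡ (no _)  _   = trans (zeroˡ _) (sym (zeroˡ _))

  ⟦⟧^⟦⟧ : ∀ {p q} {P : Set p} {Q : Set q} (a : Dec P) (b : Dec Q) → ⟦ b ⟧ ^⟦ a ⟧ ≈ ⟦ a →-dec b ⟧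
  ⟦⟧^⟦⟧ (yes p) b = ⟦⟧-cong (λ q _ → q) (λ f → f p) b (yes p →-dec b)
  ⟦⟧^⟦⟧ (no ¬p) b = sym (⟦⟧≈1 (no ¬p →-dec b) (λ p → ⊥-elim (¬p p)))

  module _ {a} {A : Set a} where

    sumList-cong : ∀ {f g : A → Carrier} xs → (∀ x → f x ≈ g x) → sumList R f xs ≈ sumList R g xs
    sumList-cong []       f≈g = ≈-refl
    sumList-cong (x ∷ xs) f≈g = +-cong (f≈g x) (sumList-cong xs f≈g)

    sumList-++ : ∀ (f : A → Carrier) xs ys → sumList R f (xs ++ ys) ≈ sumList R f xs + sumList R f ys
    sumList-++ f []       ys = sym (+-identityˡ _)
    sumList-++ f (x ∷ xs) ys = trans (+-congˡ (sumList-++ f xs ys)) (sym (+-assoc _ _ _))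

    *-distribˡ-sumList : ∀ y (f : A → Carrier) xs → y * sumList R f xs ≈ ∑[ x ∈ xs ] (y * f x)
    *-distribˡ-sumList y f []       = zeroʳ y
    *-distribˡ-sumList y f (x ∷ xs) = trans (distribˡ _ _ _) (+-congˡ (*-distribˡ-sumList y f xs))

    *-distribʳ-sumList : ∀ y (f : A → Carrier) xs → sumList R f xs * y ≈ ∑[ x ∈ xs ] (f x * y)
    *-distribʳ-sumList y f xs =
      trans (*-comm _ _) (trans (*-distribˡ-sumList y f xs) (sumList-cong xs (λ _ → *-comm _ _)))

    sumList-0# : ∀ (xs : List A) → ∑[ x ∈ xs ] 0# ≈ 0#
    sumList-0# []       = ≈-refl
    sumList-0# (x ∷ xs) = trans (+-identityˡ _) (sumList-0# xs)

    sumList-+ : ∀ (f g : A → Carrier) xs → ∑[ x ∈ xs ] (f x + g x) ≈ sumList R f xs + sumList R g xs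
    sumList-+ f g []       = sym (+-identityˡ _)
    sumList-+ f g (x ∷ xs) = begin
      (f x + g x) + ∑[ x ∈ xs ] (f x + g x)      ≈⟨ +-congˡ (sumList-+ f g xs) ⟩
      (f x + g x) + (sumList R f xs + sumList R g xs) ≈⟨ +-assoc _ _ _ ⟩
      f x + (g x + (sumList R f xs + sumList R g xs)) ≈⟨ +-congˡ (trans (sym (+-assoc _ _ _)) (+-congʳ (+-comm _ _))) ⟩
      f x + ((sumList R f xs + g x) + sumList R g xs) ≈⟨ +-congˡ (+-assoc _ _ _) ⟩
      f x + (sumList R f xs + (g x + sumList R g xs)) ≈⟨ sym (+-assoc _ _ _) ⟩
      (f x + sumList R f xs) + (g x + sumList R g xs) ∎

    sumList-filter : ∀ {p} {Q : A → Set p} (Q? : Decidable Q) (f : A → Carrier) xs →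
                     sumList R f (filter Q? xs) ≈ ∑[ x ∈ xs ] (⟦ Q? x ⟧ * f x)
    sumList-filter Q? f []       = ≈-refl
    sumList-filter Q? f (x ∷ xs) with Q? x
    ... | yes _ = +-cong (sym (*-identityˡ _)) (sumList-filter Q? f xs)
    ... | no  _ = trans (sumList-filter Q? f xs) (trans (sym (+-identityˡ _)) (+-congʳ (sym (zeroˡ _))))

    prodList-cong : ∀ {f g : A → Carrier} xs → (∀ x → f x ≈ g x) → prodList f xs ≈ prodList g xs
    prodList-cong []       f≈g = ≈-refl
    prodList-cong (x ∷ xs) f≈g = *-cong (f≈g x) (prodList-cong xs f≈g)

    prodList-* : ∀ (f g : A → Carrier) xs → ∏[ x ∈ xs ] (f x * g x) ≈ prodList f xs * prodList g xs
    prodList-* f g []       = sym (*-identityˡ _)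
    prodList-* f g (x ∷ xs) = trans (*-congˡ (prodList-* f g xs)) (*-interchange _ _ _ _)

    prodList-filter : ∀ {p} {Q : A → Set p} (Q? : Decidable Q) (f : A → Carrier) xs →
                      prodList f (filter Q? xs) ≈ ∏[ x ∈ xs ] (f x ^⟦ Q? x ⟧)
    prodList-filter Q? f []       = ≈-refl
    prodList-filter Q? f (x ∷ xs) with Q? x
    ... | yes _ = *-congˡ (prodList-filter Q? f xs)
    ... | no  _ = trans (prodList-filter Q? f xs) (sym (*-identityˡ _))

    prodList-filter-cong : ∀ {p} {Q : A → Set p} (Q? : Decidable Q) {f g : A → Carrier} xs →
                           (∀ x → Q x → f x ≈ g x) → prodList f (filter Q? xs) ≈ prodList g (filter Q? xs)
    prodList-filter-cong Q? []       f≈g = ≈-refl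
    prodList-filter-cong Q? (x ∷ xs) f≈g with Q? x
    ... | yes q = *-cong (f≈g x q) (prodList-filter-cong Q? xs f≈g)
    ... | no  _ = prodList-filter-cong Q? xs f≈g

  sumList-map : ∀ {a b} {A : Set a} {B : Set b} (f : B → Carrier) (g : A → B) xs →
                sumList R f (L.map g xs) ≈ ∑[ x ∈ xs ] f (g x)
  sumList-map f g []       = ≈-refl
  sumList-map f g (x ∷ xs) = +-congˡ (sumList-map f g xs)

  sumList-concatMap : ∀ {a b} {A : Set a} {B : Set b} (f : B → Carrier) (g : A → List B) xs →
                      sumList R f (concatMap g xs) ≈ ∑[ x ∈ xs ] sumList R f (g x)
  sumList-concatMap f g []       = ≈-refl
  sumList-concatMap f g (x ∷ xs) =
    trans (sumList-++ f (g x) (concatMap g xs)) (+-congˡ (sumList-concatMap f g xs))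

  sumList-pairs : ∀ {a b} {A : Set a} {B : Set b} (f : A × B → Carrier) xs ys →
                  sumList R f (pairs xs ys) ≈ ∑[ x ∈ xs ] ∑[ y ∈ ys ] f (x , y)
  sumList-pairs f xs ys = trans (sumList-concatMap f _ xs) (sumList-cong xs λ x → sumList-map f _ ys)

  sumList-swap : ∀ {a b} {A : Set a} {B : Set b} (f : A → B → Carrier) xs ys →
                 ∑[ x ∈ xs ] ∑[ y ∈ ys ] f x y ≈ ∑[ y ∈ ys ] ∑[ x ∈ xs ] f x y
  sumList-swap f []       ys = sym (sumList-0# ys)
  sumList-swap f (x ∷ xs) ys =
    trans (+-congˡ (sumList-swap f xs ys)) (sym (sumList-+ (f x) (λ y → ∑[ x ∈ xs ] f x y) ys))

  prodList-tabulate : ∀ {b} {B : Set b} {n} (g : B → Carrier) (f : Fin n → B) →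
                      prodList g (L.tabulate f) ≈ prodFin R (g ∘ f)
  prodList-tabulate {n = zero}  g f = ≈-refl
  prodList-tabulate {n = suc n} g f = *-congˡ (prodList-tabulate g (f ∘ F.suc))

  sumList-allFin-suc : ∀ {n} (f : Fin (suc n) → Carrier) →
                       sumList R f (allFin (suc n)) ≈ f F.zero + ∑[ x ∈ allFin n ] f (F.suc x)
  sumList-allFin-suc {n} f = +-congˡ (begin
    sumList R f (L.tabulate F.suc)           ≡⟨ cong (sumList R f) (P.sym (L.map-tabulate id F.suc)) ⟩
    sumList R f (L.map F.suc (allFin n))     ≈⟨ sumList-map f F.suc (allFin n) ⟩
    ∑[ x ∈ allFin n ] f (F.suc x)            ∎)

  -- every element of T occurs exactly once in xs
  IsEnumeration : ∀ {a} {T : Set a} → DecidableEquality T → List T → Set (a ⊔ c ⊔ ℓ)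
  IsEnumeration {T = T} _≟_ xs = ∀ v (X : T → Carrier) → ∑[ t ∈ xs ] (⟦ t ≟ v ⟧ * X t) ≈ X v

  allFin-enumeration : ∀ n → IsEnumeration F._≟_ (allFin n)
  allFin-enumeration (suc n) v X = trans (sumList-allFin-suc (λ t → ⟦ t F.≟ v ⟧ * X t)) (split v)
    where
    split : ∀ v → ⟦ F.zero F.≟ v ⟧ * X F.zero + ∑[ t ∈ allFin n ] (⟦ F.suc t F.≟ v ⟧ * X (F.suc t)) ≈ X v
    split F.zero = begin
      ⟦ F.zero {n} F.≟ F.zero ⟧ * X F.zero + ∑[ t ∈ allFin n ] (⟦ F.suc t F.≟ F.zero ⟧ * X (F.suc t))
        ≈⟨ +-cong (trans (*-congʳ (⟦⟧≈1 (F.zero {n} F.≟ F.zero) P.refl)) (*-identityˡ _))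
                  (trans (sumList-cong (allFin n) (λ t → trans (*-congʳ (⟦⟧≈0 (F.suc t F.≟ F.zero) λ ())) (zeroˡ _)))
                         (sumList-0# (allFin n))) ⟩
      X F.zero + 0# ≈⟨ +-identityʳ _ ⟩
      X F.zero      ∎
    split (F.suc v) = begin
      ⟦ F.zero F.≟ F.suc v ⟧ * X F.zero + ∑[ t ∈ allFin n ] (⟦ F.suc t F.≟ F.suc v ⟧ * X (F.suc t))
        ≈⟨ +-cong (trans (*-congʳ (⟦⟧≈0 (F.zero F.≟ F.suc v) λ ())) (zeroˡ _)) (sumList-cong (allFin n) (λ t →
             *-congʳ (⟦⟧-cong F.suc-injective (cong F.suc) (F.suc t F.≟ F.suc v) (t F.≟ v)))) ⟩
      0# + ∑[ t ∈ allFin n ] (⟦ t F.≟ v ⟧ * X (F.suc t)) ≈⟨ +-identityˡ _ ⟩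
      ∑[ t ∈ allFin n ] (⟦ t F.≟ v ⟧ * X (F.suc t))      ≈⟨ allFin-enumeration n v (X ∘ F.suc) ⟩
      X (F.suc v)                                        ∎

  concatMap-enumeration : ∀ {a b d} {A : Set a} {B : Set b} {C : Set d}
    (_≟A_ : DecidableEquality A) (_≟B_ : DecidableEquality B) (_≟C_ : DecidableEquality C) {xs ys} →
    IsEnumeration _≟A_ xs → IsEnumeration _≟B_ ys →
    (g : A → B → C) → (∀ {x x′ y y′} → g x y ≡ g x′ y′ → x ≡ x′ × y ≡ y′) →
    (∀ z → ∃₂ λ x y → g x y ≡ z) →
    IsEnumeration _≟C_ (concatMap (λ x → L.map (g x) ys) xs)
  concatMap-enumeration _≟A_ _≟B_ _≟C_ {xs} {ys} xs-enum ys-enum g g-injective g-surjective v X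
    with g-surjective v
  ... | x₀ , y₀ , P.refl = begin
    sumList R (λ t → ⟦ t ≟C g x₀ y₀ ⟧ * X t) (concatMap (λ x → L.map (g x) ys) xs)
      ≈⟨ sumList-concatMap _ _ xs ⟩
    ∑[ x ∈ xs ] sumList R (λ t → ⟦ t ≟C g x₀ y₀ ⟧ * X t) (L.map (g x) ys)
      ≈⟨ sumList-cong xs (λ x → sumList-map _ (g x) ys) ⟩
    ∑[ x ∈ xs ] ∑[ y ∈ ys ] (⟦ g x y ≟C g x₀ y₀ ⟧ * X (g x y))
      ≈⟨ sumList-cong xs (λ x → sumList-cong ys (λ y → split x y)) ⟩
    ∑[ x ∈ xs ] ∑[ y ∈ ys ] (⟦ x ≟A x₀ ⟧ * (⟦ y ≟B y₀ ⟧ * X (g x y)))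
      ≈⟨ sumList-cong xs (λ x → sym (*-distribˡ-sumList _ _ ys)) ⟩
    ∑[ x ∈ xs ] (⟦ x ≟A x₀ ⟧ * ∑[ y ∈ ys ] (⟦ y ≟B y₀ ⟧ * X (g x y)))
      ≈⟨ sumList-cong xs (λ x → *-congˡ (ys-enum y₀ (X ∘ g x))) ⟩
    ∑[ x ∈ xs ] (⟦ x ≟A x₀ ⟧ * X (g x y₀))
      ≈⟨ xs-enum x₀ (λ x → X (g x y₀)) ⟩
    X (g x₀ y₀) ∎
    where
    split : ∀ x y → ⟦ g x y ≟C g x₀ y₀ ⟧ * X (g x y) ≈ ⟦ x ≟A x₀ ⟧ * (⟦ y ≟B y₀ ⟧ * X (g x y))
    split x y = trans (*-congʳ (trans same-pair (⟦⟧-× (x ≟A x₀) (y ≟B y₀)))) (*-assoc _ _ _)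
      where
      same-pair : ⟦ g x y ≟C g x₀ y₀ ⟧ ≈ ⟦ x ≟A x₀ ×-dec y ≟B y₀ ⟧
      same-pair = ⟦⟧-cong g-injective (λ { (P.refl , P.refl) → P.refl }) (g x y ≟C g x₀ y₀) (x ≟A x₀ ×-dec y ≟B y₀)

  allVecs-enumeration : ∀ k n → IsEnumeration (V.≡-dec F._≟_) (allVecs k n)
  allVecs-enumeration zero    n V.[] X = trans (+-congʳ (*-identityˡ _)) (+-identityʳ _)
  allVecs-enumeration (suc k) n =
    concatMap-enumeration F._≟_ (V.≡-dec F._≟_) (V.≡-dec F._≟_) {allFin n} {allVecs k n}
      (allFin-enumeration n) (allVecs-enumeration k n) V._∷_ V.∷-injective (λ { (x V.∷ t) → x , t , P.refl })

  pairs-enumeration : ∀ {a b} {A : Set a} {B : Set b} (_≟A_ : DecidableEquality A) (_≟B_ : DecidableEquality B) {xs ys} →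
    IsEnumeration _≟A_ xs → IsEnumeration _≟B_ ys → IsEnumeration (×-≡-dec _≟A_ _≟B_) (pairs xs ys)
  pairs-enumeration _≟A_ _≟B_ {xs} {ys} xs-enum ys-enum =
    concatMap-enumeration _≟A_ _≟B_ (×-≡-dec _≟A_ _≟B_) {xs} {ys} xs-enum ys-enum _,_
      (λ { P.refl → P.refl , P.refl }) (λ { (x , y) → x , y , P.refl })

  sumList-reindex : ∀ {a b p q} {S : Set a} {T : Set b} (_≟S_ : DecidableEquality S) (_≟T_ : DecidableEquality T)
    {xs : List S} {ys : List T} → IsEnumeration _≟S_ xs → IsEnumeration _≟T_ ys →
    {A : S → Set p} {B : T → Set q} (A? : Decidable A) (B? : Decidable B) (from : T → S) (to : S → T) →
    (∀ s → A s → B (to s)) → (∀ s → A s → from (to s) ≡ s) →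
    (∀ t → B t → A (from t)) → (∀ t → B t → to (from t) ≡ t) →
    (F : S → Carrier) → ∑[ s ∈ xs ] (⟦ A? s ⟧ * F s) ≈ ∑[ t ∈ ys ] (⟦ B? t ⟧ * F (from t))
  sumList-reindex _≟S_ _≟T_ {xs} {ys} xs-enum ys-enum {A} {B} A? B? from to to-B from-to from-A to-from F = sym (begin
    ∑[ t ∈ ys ] (⟦ B? t ⟧ * F (from t))
      ≈⟨ sumList-cong ys (λ t → *-congˡ (sym (xs-enum (from t) F))) ⟩
    ∑[ t ∈ ys ] (⟦ B? t ⟧ * ∑[ s ∈ xs ] (⟦ s ≟S from t ⟧ * F s))
      ≈⟨ sumList-cong ys (λ t → *-distribˡ-sumList _ _ xs) ⟩
    ∑[ t ∈ ys ] ∑[ s ∈ xs ] (⟦ B? t ⟧ * (⟦ s ≟S from t ⟧ * F s))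
      ≈⟨ sumList-swap _ ys xs ⟩
    ∑[ s ∈ xs ] ∑[ t ∈ ys ] (⟦ B? t ⟧ * (⟦ s ≟S from t ⟧ * F s))
      ≈⟨ sumList-cong xs (λ s → sumList-cong ys (λ t → same-pairs s t)) ⟩
    ∑[ s ∈ xs ] ∑[ t ∈ ys ] (⟦ t ≟T to s ⟧ * (⟦ A? s ⟧ * F s))
      ≈⟨ sumList-cong xs (λ s → ys-enum (to s) (λ _ → ⟦ A? s ⟧ * F s)) ⟩
    ∑[ s ∈ xs ] (⟦ A? s ⟧ * F s) ∎)
    where
    same-pairs : ∀ s t → ⟦ B? t ⟧ * (⟦ s ≟S from t ⟧ * F s) ≈ ⟦ t ≟T to s ⟧ * (⟦ A? s ⟧ * F s)
    same-pairs s t = begin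
      ⟦ B? t ⟧ * (⟦ s ≟S from t ⟧ * F s)   ≈⟨ sym (*-assoc _ _ _) ⟩
      (⟦ B? t ⟧ * ⟦ s ≟S from t ⟧) * F s   ≈⟨ *-congʳ (sym (⟦⟧-× (B? t) (s ≟S from t))) ⟩
      ⟦ B? t ×-dec s ≟S from t ⟧ * F s
        ≈⟨ *-congʳ (⟦⟧-cong (λ { (b , P.refl) → P.sym (to-from t b) , from-A t b })
                            (λ { (P.refl , a) → to-B s a , P.sym (from-to s a) })
                            (B? t ×-dec s ≟S from t) (t ≟T to s ×-dec A? s)) ⟩
      ⟦ t ≟T to s ×-dec A? s ⟧ * F s       ≈⟨ *-congʳ (⟦⟧-× (t ≟T to s) (A? s)) ⟩
      (⟦ t ≟T to s ⟧ * ⟦ A? s ⟧) * F s     ≈⟨ *-assoc _ _ _ ⟩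
      ⟦ t ≟T to s ⟧ * (⟦ A? s ⟧ * F s)     ∎

  prodFin-cong : ∀ {m} {f g : Fin m → Carrier} → (∀ x → f x ≈ g x) → prodFin R f ≈ prodFin R g
  prodFin-cong {zero}  f≈g = ≈-refl
  prodFin-cong {suc m} f≈g = *-cong (f≈g F.zero) (prodFin-cong (f≈g ∘ F.suc))

  prodFin-* : ∀ {m} (f g : Fin m → Carrier) → prodFin R (λ x → f x * g x) ≈ prodFin R f * prodFin R g
  prodFin-* {zero}  f g = sym (*-identityˡ _)
  prodFin-* {suc m} f g = trans (*-congˡ (prodFin-* (f ∘ F.suc) (g ∘ F.suc))) (*-interchange _ _ _ _)

  prodFin-⟦⟧ : ∀ {m p} {Q : Fin m → Set p} (Q? : Decidable Q) (d : Dec (∀ x → Q x)) →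
               prodFin R (λ x → ⟦ Q? x ⟧) ≈ ⟦ d ⟧
  prodFin-⟦⟧ {zero}  Q? d = sym (⟦⟧≈1 d λ ())
  prodFin-⟦⟧ {suc m} Q? d = begin
    ⟦ Q? F.zero ⟧ * prodFin R (λ x → ⟦ Q? (F.suc x) ⟧) ≈⟨ *-congˡ (prodFin-⟦⟧ (Q? ∘ F.suc) (F.all? (Q? ∘ F.suc))) ⟩
    ⟦ Q? F.zero ⟧ * ⟦ F.all? (Q? ∘ F.suc) ⟧            ≈⟨ sym (⟦⟧-× (Q? F.zero) (F.all? (Q? ∘ F.suc))) ⟩
    ⟦ Q? F.zero ×-dec F.all? (Q? ∘ F.suc) ⟧
      ≈⟨ ⟦⟧-cong (λ (q0 , qs) → F.∀-cons q0 qs) (λ q → q F.zero , q ∘ F.suc) (Q? F.zero ×-dec F.all? (Q? ∘ F.suc)) d ⟩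
    ⟦ d ⟧                                              ∎

  prodFin-1# : ∀ m → prodFin R {m} (λ _ → 1#) ≈ 1#
  prodFin-1# zero    = ≈-refl
  prodFin-1# (suc m) = trans (*-identityˡ _) (prodFin-1# m)

  prodFin-^⟦≟⟧ : ∀ {m} (d : Fin m) (f : Fin m → Carrier) → prodFin R (λ c → f c ^⟦ d F.≟ c ⟧) ≈ f d
  prodFin-^⟦≟⟧ {suc m} F.zero    f = trans (*-congˡ (trans (prodFin-cong off-diagonal) (prodFin-1# m))) (*-identityʳ _)
    where
    off-diagonal : ∀ c → f (F.suc c) ^⟦ F.zero F.≟ F.suc c ⟧ ≈ 1#
    off-diagonal c with F.zero {m} F.≟ F.suc c
    ... | no _ = ≈-refl
  prodFin-^⟦≟⟧ {suc m} (F.suc d) f = trans (*-identityˡ _) (trans (prodFin-cong shift) (prodFin-^⟦≟⟧ d (f ∘ F.suc)))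
    where
    shift : ∀ c → f (F.suc c) ^⟦ F.suc d F.≟ F.suc c ⟧ ≈ f (F.suc c) ^⟦ d F.≟ c ⟧
    shift c with d F.≟ c | F.suc d F.≟ F.suc c
    ... | yes _    | yes _   = ≈-refl
    ... | yes d≡c  | no d≢c  = ⊥-elim (d≢c (cong F.suc d≡c))
    ... | no d≢c   | yes d≡c = ⊥-elim (d≢c (F.suc-injective d≡c))
    ... | no _     | no _    = ≈-refl

  prodFin-pow-count : ∀ {a m} {A : Set a} (p : Fin m → Carrier) (g : A → Fin m) xs →
    prodFin R (λ c → pow R (p c) (count (λ x → g x F.≟ c) xs)) ≈ ∏[ x ∈ xs ] p (g x)
  prodFin-pow-count {m = m} p g []       = prodFin-1# m
  prodFin-pow-count         p g (x ∷ xs) = begin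
    prodFin R (λ c → pow R (p c) (count (λ x → g x F.≟ c) (x ∷ xs)))
      ≈⟨ prodFin-cong peel ⟩
    prodFin R (λ c → p c ^⟦ g x F.≟ c ⟧ * pow R (p c) (count (λ x → g x F.≟ c) xs))
      ≈⟨ prodFin-* (λ c → p c ^⟦ g x F.≟ c ⟧) (λ c → pow R (p c) (count (λ x → g x F.≟ c) xs)) ⟩
    prodFin R (λ c → p c ^⟦ g x F.≟ c ⟧) * prodFin R (λ c → pow R (p c) (count (λ x → g x F.≟ c) xs))
      ≈⟨ *-cong (prodFin-^⟦≟⟧ (g x) p) (prodFin-pow-count p g xs) ⟩
    p (g x) * ∏[ x ∈ xs ] p (g x) ∎
    where
    peel : ∀ c → pow R (p c) (count (λ x → g x F.≟ c) (x ∷ xs))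
                 ≈ p c ^⟦ g x F.≟ c ⟧ * pow R (p c) (count (λ x → g x F.≟ c) xs)
    peel c with g x F.≟ c
    ... | yes _ = ≈-refl
    ... | no  _ = sym (*-identityˡ _)

  sumList-allVecs-prodFin : ∀ K m (g : Fin K → Fin m → Carrier) →
    ∑[ t ∈ allVecs K m ] prodFin R (λ x → g x (lookup t x)) ≈ prodFin R (λ x → ∑[ b ∈ allFin m ] g x b)
  sumList-allVecs-prodFin zero    m g = +-identityʳ _
  sumList-allVecs-prodFin (suc K) m g = begin
    ∑[ t ∈ allVecs (suc K) m ] prodFin R (λ x → g x (lookup t x))
      ≈⟨ sumList-concatMap _ _ (allFin m) ⟩
    ∑[ b ∈ allFin m ] sumList R (λ t → prodFin R (λ x → g x (lookup t x))) (L.map (b V.∷_) (allVecs K m))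
      ≈⟨ sumList-cong (allFin m) (λ b → sumList-map _ _ (allVecs K m)) ⟩
    ∑[ b ∈ allFin m ] ∑[ t ∈ allVecs K m ] (g F.zero b * prodFin R (λ x → g (F.suc x) (lookup t x)))
      ≈⟨ sumList-cong (allFin m) (λ b → trans (sym (*-distribˡ-sumList _ _ (allVecs K m)))
                                              (*-congˡ (sumList-allVecs-prodFin K m (g ∘ F.suc)))) ⟩
    ∑[ b ∈ allFin m ] (g F.zero b * prodFin R (λ x → ∑[ b ∈ allFin m ] g (F.suc x) b))
      ≈⟨ sym (*-distribʳ-sumList _ (g F.zero) (allFin m)) ⟩
    ∑[ b ∈ allFin m ] g F.zero b * prodFin R (λ x → ∑[ b ∈ allFin m ] g (F.suc x) b) ∎

module Colorings {c ℓ} (R : CommutativeSemiring c ℓ) where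
  open CommutativeSemiring R renaming (refl to ≈-refl)
  open Sums R
  open import Relation.Binary.Reasoning.Setoid setoid
  open import Algebra.Properties.CommutativeSemigroup *-commutativeSemigroup using ()
    renaming (x∙yz≈yx∙z to x*yz≈yx*z)

  prodList-cycleReps : ∀ {K} (u : Vec (Fin K) K) (f : Fin K → Carrier) →
                       prodList f (cycleReps u) ≈ prodFin R (λ x → f x ^⟦ isCycleMin? u x ⟧)
  prodList-cycleReps u f =
    trans (prodList-filter (isCycleMin? u) f (allFin _)) (prodList-tabulate (λ x → f x ^⟦ isCycleMin? u x ⟧) id)

  module _ {K} (u : Vec (Fin K) K) (u-perm : IsPerm u) where
    open Cycles u u-perm

    -- a coloring constant on cycles is the same as a free choice of color on each cycle minimum
    sumList-colorConst-factorises : ∀ {m} (h : Fin K → Fin (suc m) → Carrier) →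
      ∑[ φ ∈ allVecs K (suc m) ] (⟦ colorConst? u φ ⟧ * ∏[ x ∈ cycleReps u ] h x (lookup φ x))
        ≈ ∏[ x ∈ cycleReps u ] ∑[ c ∈ allFin (suc m) ] h x c
    sumList-colorConst-factorises {m} h = begin
      ∑[ φ ∈ allVecs K (suc m) ] (⟦ colorConst? u φ ⟧ * onMins φ)
        ≈⟨ sumList-reindex (V.≡-dec F._≟_) (V.≡-dec F._≟_) {allVecs K (suc m)} {allVecs K (suc m)}
             (allVecs-enumeration K (suc m)) (allVecs-enumeration K (suc m)) (colorConst? u) zeroOffMins? spread restrictToMins
             (λ φ _ → zeroOffMins-restrictToMins φ) spread-restrictToMins
             (λ t _ → colorConst-spread t) restrictToMins-spread onMins ⟩
      ∑[ t ∈ allVecs K (suc m) ] (⟦ zeroOffMins? t ⟧ * onMins (spread t))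
        ≈⟨ sumList-cong (allVecs K (suc m)) (λ t → *-congˡ (onMins-spread t)) ⟩
      ∑[ t ∈ allVecs K (suc m) ] (⟦ zeroOffMins? t ⟧ * onMins t)
        ≈⟨ sumList-cong (allVecs K (suc m)) weighted ⟩
      ∑[ t ∈ allVecs K (suc m) ] prodFin R (λ x → weight x (isCycleMin? u x) (lookup t x))
        ≈⟨ sumList-allVecs-prodFin K (suc m) (λ x → weight x (isCycleMin? u x)) ⟩
      prodFin R (λ x → ∑[ c ∈ allFin (suc m) ] weight x (isCycleMin? u x) c)
        ≈⟨ prodFin-cong (λ x → sum-weight x (isCycleMin? u x)) ⟩
      prodFin R (λ x → (∑[ c ∈ allFin (suc m) ] h x c) ^⟦ isCycleMin? u x ⟧)
        ≈⟨ sym (prodList-cycleReps u (λ x → ∑[ c ∈ allFin (suc m) ] h x c)) ⟩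
      ∏[ x ∈ cycleReps u ] ∑[ c ∈ allFin (suc m) ] h x c ∎
      where
      onMins : Vec (Fin (suc m)) K → Carrier
      onMins φ = ∏[ x ∈ cycleReps u ] h x (lookup φ x)

      onMins-spread : ∀ t → onMins (spread t) ≈ onMins t
      onMins-spread t = prodList-filter-cong (isCycleMin? u) (allFin K) λ x min →
        ≈-reflexive (cong (h x) (lookup-spread-min t min))

      weight : ∀ x → Dec (IsCycleMin u x) → Fin (suc m) → Carrier
      weight x (yes _) c = h x c
      weight x (no _)  c = ⟦ c F.≟ F.zero ⟧

      weight-split : ∀ x c → ⟦ ¬? (isCycleMin? u x) →-dec (c F.≟ F.zero) ⟧ * h x c ^⟦ isCycleMin? u x ⟧
                             ≈ weight x (isCycleMin? u x) c
      weight-split x c with isCycleMin? u x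
      ... | yes min = trans (*-congʳ (⟦⟧≈1 (¬? (yes min) →-dec (c F.≟ F.zero)) (λ ¬min → ⊥-elim (¬min min))))
                            (*-identityˡ _)
      ... | no ¬min = trans (*-identityʳ _)
                            (⟦⟧-cong (λ f → f ¬min) (λ e _ → e) (¬? (no ¬min) →-dec (c F.≟ F.zero)) (c F.≟ F.zero))

      weighted : ∀ t → ⟦ zeroOffMins? t ⟧ * onMins t ≈ prodFin R (λ x → weight x (isCycleMin? u x) (lookup t x))
      weighted t = begin
        ⟦ zeroOffMins? t ⟧ * onMins t
          ≈⟨ *-cong (sym (prodFin-⟦⟧ zero-off? (zeroOffMins? t))) (prodList-cycleReps u (λ x → h x (lookup t x))) ⟩
        prodFin R (λ x → ⟦ zero-off? x ⟧) * prodFin R (λ x → h x (lookup t x) ^⟦ isCycleMin? u x ⟧)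
          ≈⟨ sym (prodFin-* (λ x → ⟦ zero-off? x ⟧) (λ x → h x (lookup t x) ^⟦ isCycleMin? u x ⟧)) ⟩
        prodFin R (λ x → ⟦ zero-off? x ⟧ * h x (lookup t x) ^⟦ isCycleMin? u x ⟧)
          ≈⟨ prodFin-cong (λ x → weight-split x (lookup t x)) ⟩
        prodFin R (λ x → weight x (isCycleMin? u x) (lookup t x)) ∎
        where
        zero-off? : ∀ x → Dec (¬ IsCycleMin u x → lookup t x ≡ F.zero)
        zero-off? x = ¬? (isCycleMin? u x) →-dec (lookup t x F.≟ F.zero)

      sum-weight : ∀ x (min? : Dec (IsCycleMin u x)) →
                   ∑[ c ∈ allFin (suc m) ] weight x min? c ≈ (∑[ c ∈ allFin (suc m) ] h x c) ^⟦ min? ⟧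
      sum-weight x (yes _) = ≈-refl
      sum-weight x (no _)  = trans (sumList-cong (allFin (suc m)) (λ c → sym (*-identityʳ _)))
                                   (allFin-enumeration (suc m) F.zero (λ _ → 1#))

  module _ {n} (i : Fin (suc n)) where

    ⟦≡pinch⟧-self : ∀ c → ⟦ i F.≟ pinch i c ⟧ ≈ ⟦ c F.≟ inject₁ i ⟧ + ⟦ c F.≟ F.suc i ⟧
    ⟦≡pinch⟧-self c with c F.≟ F.suc i
    ... | yes P.refl = begin
      ⟦ i F.≟ pinch i (F.suc i) ⟧             ≈⟨ ⟦⟧≈1 (i F.≟ pinch i (F.suc i)) (P.sym (pinch-suc i)) ⟩
      1#                                      ≈⟨ sym (+-identityˡ _) ⟩
      0# + 1#                                 ≈⟨ +-congʳ (sym (⟦⟧≈0 (F.suc i F.≟ inject₁ i) (inject₁≢suc i ∘ P.sym))) ⟩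
      ⟦ F.suc i F.≟ inject₁ i ⟧ + 1#          ∎
    ... | no c≢suc = trans (⟦⟧-cong to from (i F.≟ pinch i c) (c F.≟ inject₁ i)) (sym (+-identityʳ _))
      where
      to : i ≡ pinch i c → c ≡ inject₁ i
      to e = P.trans (P.sym (punchIn-pinch i c≢suc)) (P.trans (cong (punchIn (F.suc i)) (P.sym e)) (punchIn-suc-self i))
      from : c ≡ inject₁ i → i ≡ pinch i c
      from P.refl = P.trans (P.sym (pinch-punchIn i i)) (cong (pinch i) (punchIn-suc-self i))

    sumList-pinch-fiber : (p : Fin (suc (suc n)) → Carrier) (d : Fin (suc n)) →
      ∑[ c ∈ allFin (suc (suc n)) ] (⟦ d F.≟ pinch i c ⟧ * p c) ≈ pMerge R i p d
    sumList-pinch-fiber p d with d F.≟ i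
    ... | yes P.refl = begin
      ∑[ c ∈ allFin (suc (suc n)) ] (⟦ d F.≟ pinch d c ⟧ * p c)
        ≈⟨ sumList-cong (allFin _) (λ c → trans (*-congʳ (⟦≡pinch⟧-self c)) (distribʳ _ _ _)) ⟩
      ∑[ c ∈ allFin (suc (suc n)) ] (⟦ c F.≟ inject₁ d ⟧ * p c + ⟦ c F.≟ F.suc d ⟧ * p c)
        ≈⟨ sumList-+ (λ c → ⟦ c F.≟ inject₁ d ⟧ * p c) (λ c → ⟦ c F.≟ F.suc d ⟧ * p c) (allFin _) ⟩
      ∑[ c ∈ allFin (suc (suc n)) ] (⟦ c F.≟ inject₁ d ⟧ * p c)
        + ∑[ c ∈ allFin (suc (suc n)) ] (⟦ c F.≟ F.suc d ⟧ * p c)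
        ≈⟨ +-cong (allFin-enumeration _ (inject₁ d) p) (allFin-enumeration _ (F.suc d) p) ⟩
      p (inject₁ d) + p (F.suc d) ∎
    ... | no d≢i = trans (sumList-cong (allFin _) (λ c → *-congʳ (⟦⟧-cong to from (d F.≟ pinch i c) (c F.≟ punchIn (F.suc i) d))))
                         (allFin-enumeration _ (punchIn (F.suc i) d) p)
      where
      to : ∀ {c} → d ≡ pinch i c → c ≡ punchIn (F.suc i) d
      to {c} e with c F.≟ F.suc i
      ... | yes P.refl = ⊥-elim (d≢i (P.trans e (pinch-suc i)))
      ... | no c≢suc   = P.trans (P.sym (punchIn-pinch i c≢suc)) (cong (punchIn (F.suc i)) (P.sym e))
      from : ∀ {c} → c ≡ punchIn (F.suc i) d → d ≡ pinch i c
      from P.refl = P.sym (pinch-punchIn i d)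

    qIdentify-pinch : (q : Fin (suc (suc n)) → Carrier) (c : Fin (suc (suc n))) → qIdentify R i q c ≡ qDrop R i q (pinch i c)
    qIdentify-pinch q c with c F.≟ F.suc i
    ... | yes P.refl = cong q (P.sym (P.trans (cong (punchIn (F.suc i)) (pinch-suc i)) (punchIn-suc-self i)))
    ... | no c≢suc   = cong q (P.sym (punchIn-pinch i c≢suc))

  module _ {K n} (u : Vec (Fin K) K) (u-perm : IsPerm u) (i : Fin (suc n)) (p : Fin (suc (suc n)) → Carrier) where
    open Cycles u u-perm

    private
      pinchV : Vec (Fin (suc (suc n))) K → Vec (Fin (suc n)) K
      pinchV = V.map (pinch i)

      infix 4 _≟_
      _≟_ : ∀ {m} → DecidableEquality (Vec (Fin m) K)
      _≟_ = V.≡-dec F._≟_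

      Πp : Vec (Fin (suc (suc n))) K → Carrier
      Πp φ = ∏[ x ∈ cycleReps u ] p (lookup φ x)

    colorConst-pinch : ∀ φ → ColorConst u φ → ColorConst u (pinchV φ)
    colorConst-pinch φ φ-const x = P.trans (V.lookup-map (lookup u x) (pinch i) φ)
      (P.trans (cong (pinch i) (φ-const x)) (P.sym (V.lookup-map x (pinch i) φ)))

    ⟦≡pinch⟧-onMins : ∀ φ′ φ → ColorConst u φ′ → ColorConst u φ →
      ⟦ φ′ ≟ pinchV φ ⟧ ≈ ∏[ x ∈ cycleReps u ] ⟦ lookup φ′ x F.≟ pinch i (lookup φ x) ⟧
    ⟦≡pinch⟧-onMins φ′ φ φ′-const φ-const = sym (begin
      ∏[ x ∈ cycleReps u ] ⟦ agrees x ⟧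
        ≈⟨ prodList-cycleReps u (λ x → ⟦ agrees x ⟧) ⟩
      prodFin R (λ x → ⟦ agrees x ⟧ ^⟦ isCycleMin? u x ⟧)
        ≈⟨ prodFin-cong (λ x → ⟦⟧^⟦⟧ (isCycleMin? u x) (agrees x)) ⟩
      prodFin R (λ x → ⟦ isCycleMin? u x →-dec agrees x ⟧)
        ≈⟨ prodFin-⟦⟧ (λ x → isCycleMin? u x →-dec agrees x) agree-on-mins? ⟩
      ⟦ agree-on-mins? ⟧
        ≈⟨ ⟦⟧-cong (colorConst-map-onMins (pinch i) φ′-const φ-const)
                   (λ e x _ → P.trans (cong (λ v → lookup v x) e) (V.lookup-map x (pinch i) φ))
                   agree-on-mins? (φ′ ≟ pinchV φ) ⟩
      ⟦ φ′ ≟ pinchV φ ⟧ ∎)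
      where
      agrees : ∀ x → Dec (lookup φ′ x ≡ pinch i (lookup φ x))
      agrees x = lookup φ′ x F.≟ pinch i (lookup φ x)
      agree-on-mins? : Dec (∀ x → IsCycleMin u x → lookup φ′ x ≡ pinch i (lookup φ x))
      agree-on-mins? = F.all? (λ x → isCycleMin? u x →-dec agrees x)

    sumList-pinch-preimage : ∀ φ′ →
      ∑[ φ ∈ allVecs K (suc (suc n)) ] (⟦ colorConst? u φ ⟧ * (⟦ φ′ ≟ pinchV φ ⟧ * Πp φ))
        ≈ ⟦ colorConst? u φ′ ⟧ * ∏[ x ∈ cycleReps u ] pMerge R i p (lookup φ′ x)
    sumList-pinch-preimage φ′ with colorConst? u φ′
    ... | yes φ′-const = begin
      ∑[ φ ∈ allVecs K (suc (suc n)) ] (⟦ colorConst? u φ ⟧ * (⟦ φ′ ≟ pinchV φ ⟧ * Πp φ))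
        ≈⟨ sumList-cong (allVecs K (suc (suc n))) (λ φ → ⟦⟧*-congˡ (colorConst? u φ) λ φ-const →
             trans (*-congʳ (⟦≡pinch⟧-onMins φ′ φ φ′-const φ-const)) (sym (prodList-* _ _ (cycleReps u)))) ⟩
      ∑[ φ ∈ allVecs K (suc (suc n)) ]
        (⟦ colorConst? u φ ⟧ * ∏[ x ∈ cycleReps u ] (⟦ lookup φ′ x F.≟ pinch i (lookup φ x) ⟧ * p (lookup φ x)))
        ≈⟨ sumList-colorConst-factorises u u-perm (λ x c → ⟦ lookup φ′ x F.≟ pinch i c ⟧ * p c) ⟩
      ∏[ x ∈ cycleReps u ] ∑[ c ∈ allFin (suc (suc n)) ] (⟦ lookup φ′ x F.≟ pinch i c ⟧ * p c)
        ≈⟨ prodList-cong (cycleReps u) (λ x → sumList-pinch-fiber i p (lookup φ′ x)) ⟩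
      ∏[ x ∈ cycleReps u ] pMerge R i p (lookup φ′ x)
        ≈⟨ sym (*-identityˡ _) ⟩
      1# * ∏[ x ∈ cycleReps u ] pMerge R i p (lookup φ′ x) ∎
    ... | no ¬φ′-const = trans (sumList-cong (allVecs K (suc (suc n))) vanishes)
                               (trans (sumList-0# (allVecs K (suc (suc n)))) (sym (zeroˡ _)))
      where
      vanishes : ∀ φ → ⟦ colorConst? u φ ⟧ * (⟦ φ′ ≟ pinchV φ ⟧ * Πp φ) ≈ 0#
      vanishes φ = begin
        ⟦ colorConst? u φ ⟧ * (⟦ φ′ ≟ pinchV φ ⟧ * Πp φ)   ≈⟨ sym (*-assoc _ _ _) ⟩
        (⟦ colorConst? u φ ⟧ * ⟦ φ′ ≟ pinchV φ ⟧) * Πp φ   ≈⟨ *-congʳ (sym (⟦⟧-× (colorConst? u φ) (φ′ ≟ pinchV φ))) ⟩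
        ⟦ colorConst? u φ ×-dec φ′ ≟ pinchV φ ⟧ * Πp φ
          ≈⟨ *-congʳ (⟦⟧≈0 (colorConst? u φ ×-dec φ′ ≟ pinchV φ)
                            (λ { (φ-const , P.refl) → ¬φ′-const (colorConst-pinch φ φ-const) })) ⟩
        0# * Πp φ                                            ≈⟨ zeroˡ _ ⟩
        0#                                                   ∎

    sumList-colorings-pinch : (H : Vec (Fin (suc n)) K → Carrier) →
      ∑[ φ ∈ allVecs K (suc (suc n)) ] (⟦ colorConst? u φ ⟧ * (Πp φ * H (pinchV φ)))
        ≈ ∑[ φ′ ∈ allVecs K (suc n) ] (⟦ colorConst? u φ′ ⟧ * (∏[ x ∈ cycleReps u ] pMerge R i p (lookup φ′ x) * H φ′))
    sumList-colorings-pinch H = begin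
      ∑[ φ ∈ allVecs K (suc (suc n)) ] (⟦ colorConst? u φ ⟧ * (Πp φ * H (pinchV φ)))
        ≈⟨ sumList-cong (allVecs K (suc (suc n))) (λ φ →
             *-congˡ (*-congˡ (sym (allVecs-enumeration K (suc n) (pinchV φ) H)))) ⟩
      ∑[ φ ∈ allVecs K (suc (suc n)) ]
        (⟦ colorConst? u φ ⟧ * (Πp φ * ∑[ φ′ ∈ allVecs K (suc n) ] (⟦ φ′ ≟ pinchV φ ⟧ * H φ′)))
        ≈⟨ sumList-cong (allVecs K (suc (suc n))) (λ φ →
             trans (*-congˡ (*-distribˡ-sumList _ _ (allVecs K (suc n))))
               (trans (*-distribˡ-sumList _ _ (allVecs K (suc n)))
                      (sumList-cong (allVecs K (suc n)) (λ φ′ → regroup _ _ _ _)))) ⟩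
      ∑[ φ ∈ allVecs K (suc (suc n)) ] ∑[ φ′ ∈ allVecs K (suc n) ] (weighted φ φ′ * H φ′)
        ≈⟨ sumList-swap _ (allVecs K (suc (suc n))) (allVecs K (suc n)) ⟩
      ∑[ φ′ ∈ allVecs K (suc n) ] ∑[ φ ∈ allVecs K (suc (suc n)) ] (weighted φ φ′ * H φ′)
        ≈⟨ sumList-cong (allVecs K (suc n)) (λ φ′ →
             trans (sym (*-distribʳ-sumList _ _ (allVecs K (suc (suc n)))))
               (trans (*-congʳ (sumList-pinch-preimage φ′)) (*-assoc _ _ _))) ⟩
      ∑[ φ′ ∈ allVecs K (suc n) ] (⟦ colorConst? u φ′ ⟧ * (∏[ x ∈ cycleReps u ] pMerge R i p (lookup φ′ x) * H φ′)) ∎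
      where
      weighted : Vec (Fin (suc (suc n))) K → Vec (Fin (suc n)) K → Carrier
      weighted φ φ′ = ⟦ colorConst? u φ ⟧ * (⟦ φ′ ≟ pinchV φ ⟧ * Πp φ)
      regroup : ∀ a b e h → a * (b * (e * h)) ≈ (a * (e * b)) * h
      regroup a b e h = trans (*-congˡ (x*yz≈yx*z b e h)) (sym (*-assoc a (e * b) h))

module Reduction {c ℓ} (R : CommutativeSemiring c ℓ) where
  open CommutativeSemiring R renaming (refl to ≈-refl)
  open Sums R
  open Colorings R
  open import Relation.Binary.Reasoning.Setoid setoid
  open import Algebra.Properties.CommutativeSemigroup *-commutativeSemigroup using ()
    renaming (x∙yz≈y∙xz to x*yz≈y*xz)

  G-summand : ∀ {k m} → Vec (Fin k) k → (p q : Fin m → Carrier) → CPerm k m → Carrier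
  G-summand w p q α = mono R p α * mono R q (α ⋆ w)

  mono≈prodList-cycleReps : ∀ {k m} (p : Fin m → Carrier) (u : Vec (Fin k) k) (φ : Vec (Fin m) k) →
                            mono R p (u , φ) ≈ ∏[ x ∈ cycleReps u ] p (lookup φ x)
  mono≈prodList-cycleReps p u φ = prodFin-pow-count p (lookup φ) (cycleReps u)

  mono-⋆-qIdentify : ∀ {k n} (i : Fin (suc n)) (q : Fin (suc (suc n)) → Carrier) (w u : Vec (Fin (suc k)) (suc k)) φ →
    mono R (qIdentify R i q) ((u , φ) ⋆ w) ≈ mono R (qDrop R i q) ((u , V.map (pinch i) φ) ⋆ w)
  mono-⋆-qIdentify {k} {n} i q w u φ = begin
    mono R (qIdentify R i q) ((u , φ) ⋆ w)
      ≈⟨ mono≈prodList-cycleReps (qIdentify R i q) (u · w) ψ ⟩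
    ∏[ x ∈ cycleReps (u · w) ] qIdentify R i q (lookup ψ x)
      ≈⟨ prodList-cong (cycleReps (u · w)) (λ x →
           ≈-reflexive (P.trans (qIdentify-pinch i q (lookup ψ x)) (cong (qDrop R i q) (pinch-ψ x)))) ⟩
    ∏[ x ∈ cycleReps (u · w) ] qDrop R i q (lookup ψ′ x)
      ≈⟨ sym (mono≈prodList-cycleReps (qDrop R i q) (u · w) ψ′) ⟩
    mono R (qDrop R i q) ((u , V.map (pinch i) φ) ⋆ w) ∎
    where
    ψ : Vec (Fin (suc (suc n))) (suc k)
    ψ = tabulate (maxAlong (u · w) φ k)
    ψ′ : Vec (Fin (suc n)) (suc k)
    ψ′ = tabulate (maxAlong (u · w) (V.map (pinch i) φ) k)
    pinch-ψ : ∀ x → pinch i (lookup ψ x) ≡ lookup ψ′ x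
    pinch-ψ x = P.trans (cong (pinch i) (V.lookup∘tabulate (maxAlong (u · w) φ k) x))
      (P.trans (P.sym (maxAlong-pinch i (u · w) φ k x)) (P.sym (V.lookup∘tabulate (maxAlong (u · w) (V.map (pinch i) φ) k) x)))

  module _ {k m : ℕ} (w : Vec (Fin (suc k)) (suc k)) (w-perm : IsPerm w) where
    private
      K : ℕ
      K = suc k
      Candidates : List (CPerm K m)
      Candidates = pairs (allVecs K K) (allVecs K m)
      infix 4 _≟_
      _≟_ : DecidableEquality (CPerm K m)
      _≟_ = ×-≡-dec (V.≡-dec F._≟_) (V.≡-dec F._≟_)

    sumList-allCPerms-⋆ : ∀ (q : Fin m → Carrier) (α : CPerm K m) → IsCPerm α →
      ∑[ β ∈ allCPerms K m ] (⟦ α ⋆ w ≟ β ⟧ * mono R q β) ≈ mono R q (α ⋆ w)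
    sumList-allCPerms-⋆ q α α-cperm = begin
      ∑[ β ∈ allCPerms K m ] (⟦ α ⋆ w ≟ β ⟧ * mono R q β)
        ≈⟨ sumList-filter isCPerm? _ Candidates ⟩
      ∑[ β ∈ Candidates ] (⟦ isCPerm? β ⟧ * (⟦ α ⋆ w ≟ β ⟧ * mono R q β))
        ≈⟨ sumList-cong Candidates (λ β →
             trans (x*yz≈y*xz _ _ _) (*-congʳ (⟦⟧-cong P.sym P.sym (α ⋆ w ≟ β) (β ≟ α ⋆ w)))) ⟩
      ∑[ β ∈ Candidates ] (⟦ β ≟ α ⋆ w ⟧ * (⟦ isCPerm? β ⟧ * mono R q β))
        ≈⟨ pairs-enumeration (V.≡-dec F._≟_) (V.≡-dec F._≟_) {allVecs K K} {allVecs K m}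
             (allVecs-enumeration K K) (allVecs-enumeration K m) (α ⋆ w) (λ β → ⟦ isCPerm? β ⟧ * mono R q β) ⟩
      ⟦ isCPerm? (α ⋆ w) ⟧ * mono R q (α ⋆ w)
        ≈⟨ trans (*-congʳ (⟦⟧≈1 (isCPerm? (α ⋆ w)) (⋆-isCPerm {α = α} {w} α-cperm w-perm))) (*-identityˡ _) ⟩
      mono R q (α ⋆ w) ∎

    G-as-sum : ∀ (p q : Fin m → Carrier) → G R m w p q ≈
      ∑[ u ∈ allVecs K K ] (⟦ isPerm? u ⟧ * ∑[ φ ∈ allVecs K m ] (⟦ colorConst? u φ ⟧ * G-summand w p q (u , φ)))
    G-as-sum p q = begin
      G R m w p q
        ≈⟨ sumList-filter (λ αβ → proj₁ αβ ⋆ w ≟ proj₂ αβ) _ (pairs (allCPerms K m) (allCPerms K m)) ⟩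
      ∑[ αβ ∈ pairs (allCPerms K m) (allCPerms K m) ]
        (⟦ proj₁ αβ ⋆ w ≟ proj₂ αβ ⟧ * (mono R p (proj₁ αβ) * mono R q (proj₂ αβ)))
        ≈⟨ sumList-pairs _ (allCPerms K m) (allCPerms K m) ⟩
      ∑[ α ∈ allCPerms K m ] ∑[ β ∈ allCPerms K m ] (⟦ α ⋆ w ≟ β ⟧ * (mono R p α * mono R q β))
        ≈⟨ sumList-cong (allCPerms K m) (λ α →
             trans (sumList-cong (allCPerms K m) (λ β → x*yz≈y*xz _ _ _)) (sym (*-distribˡ-sumList _ _ (allCPerms K m)))) ⟩
      ∑[ α ∈ allCPerms K m ] (mono R p α * ∑[ β ∈ allCPerms K m ] (⟦ α ⋆ w ≟ β ⟧ * mono R q β))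
        ≈⟨ sumList-filter isCPerm? _ Candidates ⟩
      ∑[ α ∈ Candidates ] (⟦ isCPerm? α ⟧ * (mono R p α * ∑[ β ∈ allCPerms K m ] (⟦ α ⋆ w ≟ β ⟧ * mono R q β)))
        ≈⟨ sumList-cong Candidates (λ α →
             ⟦⟧*-congˡ (isCPerm? α) (λ α-cperm → *-congˡ (sumList-allCPerms-⋆ q α α-cperm))) ⟩
      ∑[ α ∈ Candidates ] (⟦ isCPerm? α ⟧ * G-summand w p q α)
        ≈⟨ sumList-pairs _ (allVecs K K) (allVecs K m) ⟩
      ∑[ u ∈ allVecs K K ] ∑[ φ ∈ allVecs K m ] (⟦ isPerm? u ×-dec colorConst? u φ ⟧ * G-summand w p q (u , φ))
        ≈⟨ sumList-cong (allVecs K K) (λ u →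
             trans (sumList-cong (allVecs K m) (λ φ → trans (*-congʳ (⟦⟧-× (isPerm? u) (colorConst? u φ))) (*-assoc _ _ _)))
                   (sym (*-distribˡ-sumList _ _ (allVecs K m)))) ⟩
      ∑[ u ∈ allVecs K K ] (⟦ isPerm? u ⟧ * ∑[ φ ∈ allVecs K m ] (⟦ colorConst? u φ ⟧ * G-summand w p q (u , φ))) ∎

  sumList-colorings-merge : ∀ {k n} (w u : Vec (Fin (suc k)) (suc k)) → IsPerm u →
    (i : Fin (suc n)) (p q : Fin (suc (suc n)) → Carrier) →
    ∑[ φ ∈ allVecs (suc k) (suc (suc n)) ] (⟦ colorConst? u φ ⟧ * G-summand w p (qIdentify R i q) (u , φ))
      ≈ ∑[ φ′ ∈ allVecs (suc k) (suc n) ] (⟦ colorConst? u φ′ ⟧ * G-summand w (pMerge R i p) (qDrop R i q) (u , φ′))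
  sumList-colorings-merge {k} {n} w u u-perm i p q = begin
    ∑[ φ ∈ allVecs (suc k) (suc (suc n)) ] (⟦ colorConst? u φ ⟧ * G-summand w p (qIdentify R i q) (u , φ))
      ≈⟨ sumList-cong (allVecs (suc k) (suc (suc n))) (λ φ →
           *-congˡ (*-cong (mono≈prodList-cycleReps p u φ) (mono-⋆-qIdentify i q w u φ))) ⟩
    ∑[ φ ∈ allVecs (suc k) (suc (suc n)) ]
      (⟦ colorConst? u φ ⟧ * (∏[ x ∈ cycleReps u ] p (lookup φ x) * H (V.map (pinch i) φ)))
      ≈⟨ sumList-colorings-pinch u u-perm i p H ⟩
    ∑[ φ′ ∈ allVecs (suc k) (suc n) ] (⟦ colorConst? u φ′ ⟧ * (∏[ x ∈ cycleReps u ] pMerge R i p (lookup φ′ x) * H φ′))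
      ≈⟨ sumList-cong (allVecs (suc k) (suc n)) (λ φ′ →
           *-congˡ (*-congʳ (sym (mono≈prodList-cycleReps (pMerge R i p) u φ′)))) ⟩
    ∑[ φ′ ∈ allVecs (suc k) (suc n) ] (⟦ colorConst? u φ′ ⟧ * G-summand w (pMerge R i p) (qDrop R i q) (u , φ′)) ∎
    where
    H : Vec (Fin (suc n)) (suc k) → Carrier
    H φ′ = mono R (qDrop R i q) ((u , φ′) ⋆ w)

proposition2 : ∀ {c ℓ} (R : CommutativeSemiring c ℓ) (k n : ℕ) → 1 ≤ k
    → (μ : List ℕ) → IsPartition k μ
    → (w : Vec (Fin k) k) → IsPerm w → HasCycleType w μ
    → (p q : Fin (suc (suc n)) → CommutativeSemiring.Carrier R)
    → (i : Fin (suc n))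
    → CommutativeSemiring._≈_ R
        (G R (suc (suc n)) w p (qIdentify R i q))
        (G R (suc n) w (pMerge R i p) (qDrop R i q))
proposition2 R zero    n ()
proposition2 R (suc k) n _ μ _ w w-perm _ p q i =
  trans (G-as-sum w w-perm p (qIdentify R i q))
    (trans (sumList-cong (allVecs (suc k) (suc k)) λ u →
              ⟦⟧*-congˡ (isPerm? u) λ u-perm → sumList-colorings-merge w u u-perm i p q)
      (sym (G-as-sum w w-perm (pMerge R i p) (qDrop R i q))))
  where
  open CommutativeSemiring R
  open Sums R
  open Reduction R
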